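{- Let $(C, I, O)$ be an ILP Modulo $T$ instance and consider the $\mathrm{BC}(T)$ transition system for it. If $\langle \{\langle C, \emptyset\rangle\}, \mathrm{none}\rangle \longrightarrow^* \langle \emptyset, A\rangle$ where $A \neq \mathrm{none}$ (possibly annotated with $-\infty$), then (a) $A$ is a $T$-model of $C \wedge I$, and (b) there is no integer assignment $B$ such that $B$ is a $T$-model of $C \wedge I$ and $obj(B) < obj(A)$.
   Context: Fix a set $\mathcal V$ of integer variables. An integer linear constraint has the form $c_1v_1+\dots+c_nv_n \bowtie r$ with integers $c_i, r$, $v_i \in \mathcal V$, $\bowtie \in \{<,\le,=,>,\ge\}$; an integer linear formula is a finite set (conjunction) of such constraints. An integer assignment is a function $A:\mathcal V\to\mathbb Z$, identified with the set of formulas $\{v = A(v) : v\in\mathcal V\}$. $\mathcal Z$ denotes the theory of linear integer arithmetic (all first-order sentences over the signature $0,\pm1,\pm2,\dots,+,-,\le$ true in the standard model $\mathbb Z$). For a theory $T'$, a formula $F$ is $T'$-consistent if $F\wedge T'$ has a model, and $F\models_{T'} G$ means $F\wedge\neg G$ is $T'$-inconsistent. Let $T$ be a $\Sigma$-theory with $\Sigma$ disjoint from the signature of $\mathcal Z$. A $\Sigma$-interface atom is a $\Sigma$-atomic formula $t$, possibly annotated with a variable $v$ (written $t^v$), the annotation meaning $t \Leftrightarrow v>0$. An ILP Modulo $T$ instance is a triple $(C, I, O)$ with $C$ an integer linear formula, $I$ a set of $\Sigma$-interface atoms, and $O=\sum_i c_i v_i$ an integer linear expression to be minimized. For an assignment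 $A$, $obj(A)=\sum_i c_iA(v_i)$; also $obj(\mathrm{none})=+\infty$ and $obj(A^{ -\infty})=-\infty$. An assignment $A$ (or $A^{ -\infty}$, referring to its underlying assignment) is a $T$-model of a formula $F$ if $A$ is $T$-consistent and $A\models_{\mathcal Z\cup T} F$. A simple equality is a constraint $v_i=c$ or $v_i-v_j=c$ ($c$ an integer constant). A subproblem is a pair $\langle C, D\rangle$ with $C$ a set of integer linear constraints and $D$ a set of simple equalities. A state is a pair $\langle P, A\rangle$ where $P$ is a set of subproblems and $A$ is either the constant $\mathrm{none}$, an assignment, or an assignment annotated with superscript $-\infty$. A fixed function $lb$ on subproblems satisfies: no assignment $A$ satisfying $C\wedge D$ has $obj(A) < lb(\langle C,D\rangle)$. Notation: $P\uplus Q$ is union of disjoint sets; $C\,c$ is $C\cup\{c\}$ with $c\notin C$ (likewise $D\,d$). The transition relation $\longrightarrow$ of $\mathrm{BC}(T)$ is given by the rules: Branch: $\langle P\uplus\{\langle C,D\rangle\}, A\rangle \longrightarrow \langle P\cup\{\langle C_i,D\rangle : 1\le i\le n\}, A\rangle$ if $n>1$, $D\models_{\mathcal Z}(C\Leftrightarrow\bigvee_{i} C_i)$, and the $C_i$ are syntactically distinct. Learn: $\langle P\uplus\{\langle C,D\rangle\},A\rangle\longrightarrow\langle P\cup\{\langle C\,c,D\rangle\},A\rangle$ if $C\wedge D\models_{\mathcal Z} c$. Forget: $\langle P\uplus\{\langle C\,c,D\rangle\},A\rangle\longrightarrow\langle P\cup\{\langle C,D\rangle\},A\rangle$ if $C\wedge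 D\models_{\mathcal Z} c$. Propagate: $\langle P\uplus\{\langle C,D\rangle\},A\rangle\longrightarrow\langle P\cup\{\langle C,D\,d\rangle\},A\rangle$ if $d$ is a simple equality and $C\wedge D\models_{\mathcal Z} d$. Drop: $\langle P\uplus\{\langle C,D\rangle\},A\rangle\longrightarrow\langle P,A\rangle$ if $C\wedge D$ has no integer solution. Prune: $\langle P\uplus\{\langle C,D\rangle\},A\rangle\longrightarrow\langle P,A\rangle$ if $A\neq\mathrm{none}$ and $lb(\langle C,D\rangle)\ge obj(A)$. Retire: $\langle P\uplus\{\langle C,D\rangle\},A\rangle\longrightarrow\langle P,A'\rangle$ if $A'$ is a $T$-model of $C\wedge D\wedge I$, $obj(A')<obj(A)$, and $obj(A')\le obj(B)$ for every $T$-model $B$ of $C\wedge D\wedge I$. Unbounded: $\langle P\uplus\{\langle C,D\rangle\},A\rangle\longrightarrow\langle \emptyset,A'^{ -\infty}\rangle$ if $A'$ is a $T$-model of $C\wedge D\wedge I$, $obj(A')\le obj(A)$, and for every $k$ there is a $T$-model $B$ of $C\wedge D\wedge I$ with $obj(B)<k$. T-Learn: $\langle P\uplus\{\langle C,D\rangle\},A\rangle\longrightarrow\langle P\cup\{\langle C\,c,D\rangle\},A\rangle$ if there is a formula $F$ with $C\wedge D\models_{\mathcal Z} F$ and $F\wedge I\models_T c$. $S\longrightarrow^* S'$ means $S=S'$ or there is a finite nonempty chain of $\longrightarrow$ transitions from $S$ to $S'$. -}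

module Defs where

open import Data.Integer using (ℤ; +_; -[1+_]; 0ℤ; _+_; _*_; _<_; _≤_; _>_; _≥_)
open import Data.List using (List; []; _∷_; _++_; length)
open import Data.List.Membership.Propositional using (_∈_; _∉_)
open import Data.List.Relation.Unary.All using (All)
open import Data.List.Relation.Unary.Any using (Any)
open import Data.List.Relation.Unary.AllPairs using (AllPairs)
open import Data.Maybe using (Maybe; just; nothing)
open import Data.Nat using (ℕ) renaming (_<_ to _<ℕ_)
open import Data.Product using (Σ; ∃; _×_; _,_)
open import Relation.Binary.PropositionalEquality using (_≡_; _≢_)
open import Relation.Nullary using (¬_)

-- Extended integers (for obj(none) = +∞, obj(A^{-∞}) = -∞, and lb)

data ℤ∞ : Set where
  -∞  : ℤ∞
  fin : ℤ → ℤ∞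
  +∞  : ℤ∞

data _≤∞_ : ℤ∞ → ℤ∞ → Set where
  -∞≤     : ∀ {x} → -∞ ≤∞ x
  fin≤fin : ∀ {a b} → a ≤ b → fin a ≤∞ fin b
  ≤+∞     : ∀ {x} → x ≤∞ +∞

data _<∞_ : ℤ∞ → ℤ∞ → Set where
  -∞<fin  : ∀ {a} → -∞ <∞ fin a
  -∞<+∞   : -∞ <∞ +∞
  fin<fin : ∀ {a b} → a < b → fin a <∞ fin b
  fin<+∞  : ∀ {a} → fin a <∞ +∞

Assignment : Set → Set
Assignment V = V → ℤ

LinExpr : Set → Set
LinExpr V = List (ℤ × V)

eval : ∀ {V : Set} → Assignment V → LinExpr V → ℤ
eval α []             = 0ℤ
eval α ((c , v) ∷ ts) = c * α v + eval α ts

data Rel : Set where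
  lt le eq gt ge : Rel

record Constraint (V : Set) : Set where
  constructor mkC
  field
    terms : LinExpr V
    rel   : Rel
    rhs   : ℤ

⟦_⟧c : ∀ {V : Set} → Constraint V → Assignment V → Set
⟦ mkC ts lt r ⟧c α = eval α ts < r
⟦ mkC ts le r ⟧c α = eval α ts ≤ r
⟦ mkC ts eq r ⟧c α = eval α ts ≡ r
⟦ mkC ts gt r ⟧c α = eval α ts > r
⟦ mkC ts ge r ⟧c α = eval α ts ≥ r

-- an integer linear formula: a finite set (conjunction) of constraints,
-- represented by a list
ILF : Set → Set
ILF V = List (Constraint V)

⟦_⟧f : ∀ {V : Set} → ILF V → Assignment V → Set
⟦ C ⟧f α = All (λ c → ⟦ c ⟧c α) C

data SimpleEq {V : Set} : Constraint V → Set where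
  var=c   : ∀ v r → SimpleEq (mkC ((+ 1 , v) ∷ []) eq r)
  var-var : ∀ vi vj r → SimpleEq (mkC ((+ 1 , vi) ∷ (-[1+ 0 ] , vj) ∷ []) eq r)

_≋_ : ∀ {V : Set} → ILF V → ILF V → Set
C ≋ C' = ∀ c → (c ∈ C → c ∈ C') × (c ∈ C' → c ∈ C)

-- Str: Σ-structures (interpreting
-- the symbols of Σ); Sat m α: the combined structure consisting of the
-- standard integers with the variables valued by α and the Σ-part m is a
-- model of T; holds m α t: the Σ-atom t is true there.

record Theory (V : Set) : Set₁ where
  field
    Atom  : Set
    Str   : Set
    Sat   : Str → Assignment V → Set
    holds : Str → Assignment V → Atom → Set

module _ {V : Set} (T : Theory V) where
  open Theory T

  record IAtom : Set where
    constructor mkIA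
    field
      atom : Atom
      ann  : Maybe V

  ⟦_⟧ia : IAtom → Assignment V → Str → Set
  ⟦ mkIA t nothing  ⟧ia α m = holds m α t
  ⟦ mkIA t (just v) ⟧ia α m = (holds m α t → α v > + 0) × (α v > + 0 → holds m α t)

  ⟦_⟧I : List IAtom → Assignment V → Str → Set
  ⟦ I ⟧I α m = All (λ a → ⟦ a ⟧ia α m) I

  -- formulas in the combined language, given semantically
  CForm : Set₁
  CForm = Assignment V → Str → Set

  TConsistent : Assignment V → Set
  TConsistent α = ∃ λ (m : Str) → Sat m α

  Entails : Assignment V → CForm → Set
  Entails α F = ∀ (m : Str) → Sat m α → F α m

  TModel : Assignment V → CForm → Set
  TModel α F = TConsistent α × Entails α F

  record Instance : Set where
    constructor mkInst
    field
      Cn : ILF V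
      I  : List IAtom
      O  : LinExpr V

  record Subproblem : Set where
    constructor ⟨_,_⟩
    field
      SC : ILF V
      SD : ILF V

  open Subproblem

  _≈s_ : Subproblem → Subproblem → Set
  s ≈s t = (SC s ≋ SC t) × (SD s ≋ SD t)

  _∈s_ : Subproblem → List Subproblem → Set
  s ∈s P = Any (λ t → s ≈s t) P

  _≋P_ : List Subproblem → List Subproblem → Set
  P ≋P Q = ∀ s → (s ∈s P → s ∈s Q) × (s ∈s Q → s ∈s P)

  Split : List Subproblem → Subproblem → List Subproblem → Set
  Split P s P₀ = (P ≋P (s ∷ P₀)) × ¬ (s ∈s P₀)

  data Best : Set where
    none : Best
    asg  : Assignment V → Best
    unb  : Assignment V → Best

  State : Set
  State = List Subproblem × Best

  module _ (inst : Instance) where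
    open Instance inst

    obj : Assignment V → ℤ
    obj α = eval α O

    objB : Best → ℤ∞
    objB none    = +∞
    objB (asg α) = fin (obj α)
    objB (unb α) = -∞

    CDI : Subproblem → CForm
    CDI s α m = ⟦ SC s ⟧f α × ⟦ SD s ⟧f α × ⟦ I ⟧I α m

    CI : CForm
    CI α m = ⟦ Cn ⟧f α × ⟦ I ⟧I α m

    ValidLB : (Subproblem → ℤ∞) → Set
    ValidLB lb = ∀ s α → ⟦ SC s ⟧f α → ⟦ SD s ⟧f α → ¬ (fin (obj α) <∞ lb s)

    data Step (lb : Subproblem → ℤ∞) : State → State → Set₁ where
      branch : ∀ {P P₀ P' A} C D (Cs : List (ILF V)) →
        Split P ⟨ C , D ⟩ P₀ →
        1 <ℕ length Cs →
        (∀ α → ⟦ D ⟧f α → (⟦ C ⟧f α → Any (λ Ci → ⟦ Ci ⟧f α) Cs)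
                         × (Any (λ Ci → ⟦ Ci ⟧f α) Cs → ⟦ C ⟧f α)) →
        AllPairs (λ Ci Cj → ¬ (Ci ≋ Cj)) Cs →
        P' ≋P (Data.List.map (λ Ci → ⟨ Ci , D ⟩) Cs ++ P₀) →
        Step lb (P , A) (P' , A)
      learn : ∀ {P P₀ P' A} C D c →
        Split P ⟨ C , D ⟩ P₀ → c ∉ C →
        (∀ α → ⟦ C ⟧f α → ⟦ D ⟧f α → ⟦ c ⟧c α) →
        P' ≋P (⟨ c ∷ C , D ⟩ ∷ P₀) →
        Step lb (P , A) (P' , A)
      forget : ∀ {P P₀ P' A} C D c →
        Split P ⟨ c ∷ C , D ⟩ P₀ → c ∉ C →
        (∀ α → ⟦ C ⟧f α → ⟦ D ⟧f α → ⟦ c ⟧c α) →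
        P' ≋P (⟨ C , D ⟩ ∷ P₀) →
        Step lb (P , A) (P' , A)
      propagate : ∀ {P P₀ P' A} C D d →
        Split P ⟨ C , D ⟩ P₀ → d ∉ D → SimpleEq d →
        (∀ α → ⟦ C ⟧f α → ⟦ D ⟧f α → ⟦ d ⟧c α) →
        P' ≋P (⟨ C , d ∷ D ⟩ ∷ P₀) →
        Step lb (P , A) (P' , A)
      drop : ∀ {P P₀ P' A} s →
        Split P s P₀ →
        (∀ α → ¬ (⟦ SC s ⟧f α × ⟦ SD s ⟧f α)) →
        P' ≋P P₀ →
        Step lb (P , A) (P' , A)
      prune : ∀ {P P₀ P' A} s →
        Split P s P₀ → A ≢ none →
        objB A ≤∞ lb s →
        P' ≋P P₀ →
        Step lb (P , A) (P' , A)
      retire : ∀ {P P₀ P' A} s (A' : Assignment V) →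
        Split P s P₀ →
        TModel A' (CDI s) →
        fin (obj A') <∞ objB A →
        (∀ β → TModel β (CDI s) → obj A' ≤ obj β) →
        P' ≋P P₀ →
        Step lb (P , A) (P' , asg A')
      unbounded : ∀ {P P₀ A} s (A' : Assignment V) →
        Split P s P₀ →
        TModel A' (CDI s) →
        fin (obj A') ≤∞ objB A →
        (∀ (k : ℤ) → ∃ λ β → TModel β (CDI s) × obj β < k) →
        Step lb (P , A) ([] , unb A')
      t-learn : ∀ {P P₀ P' A} C D c →
        Split P ⟨ C , D ⟩ P₀ → c ∉ C →
        (∃ λ (F : Assignment V → Set) →
            (∀ α → ⟦ C ⟧f α → ⟦ D ⟧f α → F α)
          × (∀ α m → Sat m α → F α → ⟦ I ⟧I α m → ⟦ c ⟧c α)) →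
        P' ≋P (⟨ c ∷ C , D ⟩ ∷ P₀) →
        Step lb (P , A) (P' , A)

    initial : State
    initial = (⟨ Cn , [] ⟩ ∷ [] , none)

-- Every reachable state ⟨P, A⟩ satisfies a three-part invariant: A, when it is an
-- assignment, is a T-model of C ∧ I; every subproblem of P entails C; and every
-- T-model of C ∧ I strictly better than A satisfies some subproblem of P.
-- Branch, Learn, Forget, Propagate and T-Learn only replace a subproblem by
-- subproblems with the same T-models of C ∧ I, while Drop, Prune and Retire only
-- discard subproblems that have no strictly better T-model (by infeasibility, the
-- validity of lb, and the optimality condition of Retire respectively).
-- Unbounded leaves nothing strictly better than -∞.  Once P = ∅ the last part of
-- the invariant says that no T-model of C ∧ I is better than A.
module Submission where

open import Data.Empty using (⊥-elim)
open import Data.Integer using (ℤ; _≤_)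
import Data.Integer.Properties as ℤ
open import Data.List using (List; []; _∷_; _++_; map)
open import Data.List.Relation.Unary.All as All using ([]; _∷_)
open import Data.List.Relation.Unary.Any as Any using (Any; here; there)
open import Data.List.Relation.Unary.Any.Properties using (++⁺ˡ; ++⁺ʳ; ++⁻; map⁺; map⁻)
open import Data.Product using (_×_; _,_; ∃; proj₁; proj₂)
open import Data.Sum using (_⊎_; inj₁; inj₂)
open import Function using (id; _∘_)
open import Relation.Binary.PropositionalEquality using (_≡_; refl)
open import Relation.Binary.Construct.Closure.ReflexiveTransitive using (Star; fold)
open import Relation.Nullary using (¬_)
open import Defs

<∞-trans : ∀ {a b c} → a <∞ b → b <∞ c → a <∞ c
<∞-trans -∞<fin      (fin<fin _) = -∞<fin
<∞-trans -∞<fin      fin<+∞      = -∞<+∞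
<∞-trans (fin<fin p) (fin<fin q) = fin<fin (ℤ.<-trans p q)
<∞-trans (fin<fin _) fin<+∞      = fin<+∞

<∞-≤∞-trans : ∀ {a b c} → a <∞ b → b ≤∞ c → a <∞ c
<∞-≤∞-trans -∞<fin      (fin≤fin _) = -∞<fin
<∞-≤∞-trans -∞<fin      ≤+∞         = -∞<+∞
<∞-≤∞-trans -∞<+∞       ≤+∞         = -∞<+∞
<∞-≤∞-trans (fin<fin p) (fin≤fin q) = fin<fin (ℤ.<-≤-trans p q)
<∞-≤∞-trans (fin<fin _) ≤+∞         = fin<+∞
<∞-≤∞-trans fin<+∞      ≤+∞         = fin<+∞

⟦⟧f-resp-≋ : ∀ {V : Set} {C C' : ILF V} {α : Assignment V} → C ≋ C' → ⟦ C ⟧f α → ⟦ C' ⟧f α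
⟦⟧f-resp-≋ C≋C' sat = All.tabulate (λ {c} c∈C' → All.lookup sat (proj₂ (C≋C' c) c∈C'))

≋-refl : ∀ {V : Set} {C : ILF V} → C ≋ C
≋-refl c = id , id

module Soundness {V : Set} (T : Theory V) (inst : Instance T) where
  open Instance inst
  open Subproblem

  infix 4 _≈_ _∈P_ _≋ₚ_

  _≈_ : Subproblem T → Subproblem T → Set
  _≈_ = _≈s_ T

  _∈P_ : Subproblem T → List (Subproblem T) → Set
  _∈P_ = _∈s_ T

  _≋ₚ_ : List (Subproblem T) → List (Subproblem T) → Set
  _≋ₚ_ = _≋P_ T

  ⟦_⟧s : Subproblem T → Assignment V → Set
  ⟦ s ⟧s α = ⟦ SC s ⟧f α × ⟦ SD s ⟧f α

  ≈-refl : ∀ {s} → s ≈ s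
  ≈-refl = ≋-refl , ≋-refl

  ⟦⟧s-resp-≈ : ∀ {s t α} → s ≈ t → ⟦ s ⟧s α → ⟦ t ⟧s α
  ⟦⟧s-resp-≈ (C≋ , D≋) (satC , satD) = ⟦⟧f-resp-≋ C≋ satC , ⟦⟧f-resp-≋ D≋ satD

  satisfied-∈P : ∀ {Q β} → Any (λ t → ⟦ t ⟧s β) Q → ∃ λ t → t ∈P Q × ⟦ t ⟧s β
  satisfied-∈P (here sat)  = _ , here ≈-refl , sat
  satisfied-∈P (there sat) = let t , t∈Q , satt = satisfied-∈P sat in t , there t∈Q , satt

  ∈P-satisfied : ∀ {Q t α} → t ∈P Q → ⟦ t ⟧s α → Any (λ u → ⟦ u ⟧s α) Q
  ∈P-satisfied t∈Q sat = Any.map (λ t≈u → ⟦⟧s-resp-≈ t≈u sat) t∈Q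

  module _ {P s P₀} (split : Split T P s P₀) where

    Split-∈ : s ∈P P
    Split-∈ = proj₂ (proj₁ split s) (here ≈-refl)

    Split-⊆ : ∀ {t} → t ∈P P₀ → t ∈P P
    Split-⊆ {t} t∈P₀ = proj₂ (proj₁ split t) (there t∈P₀)

    Split-∈⁻ : ∀ {t} → t ∈P P → t ≈ s ⊎ t ∈P P₀
    Split-∈⁻ {t} t∈P with proj₁ (proj₁ split t) t∈P
    ... | here t≈s    = inj₁ t≈s
    ... | there t∈P₀ = inj₂ t∈P₀

  IsModel : Assignment V → Set
  IsModel α = TModel T α (CI T inst)

  _isBetterThan_ : Assignment V → Best T → Set
  β isBetterThan A = fin (obj T inst β) <∞ objB T inst A

  BestIsModel : Best T → Set
  BestIsModel A = ∀ α → A ≡ asg α ⊎ A ≡ unb α → IsModel α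

  Refines : List (Subproblem T) → Set
  Refines P = ∀ s → s ∈P P → ∀ α → ⟦ s ⟧s α → ⟦ Cn ⟧f α

  Covers : List (Subproblem T) → Best T → Set
  Covers P A = ∀ β → IsModel β → β isBetterThan A → ∃ λ s → s ∈P P × ⟦ s ⟧s β

  Invariant : State T → Set
  Invariant (P , A) = BestIsModel A × Refines P × Covers P A

  Invariant-initial : Invariant (initial T inst)
  Invariant-initial = best , refines , covers
    where
    best : BestIsModel none
    best α (inj₁ ())
    best α (inj₂ ())
    refines : Refines (⟨ Cn , [] ⟩ ∷ [])
    refines s (here (C≋ , _)) α (satC , _) = ⟦⟧f-resp-≋ C≋ satC
    covers : Covers (⟨ Cn , [] ⟩ ∷ []) none
    covers β ((m , sat) , entails) _ = _ , here ≈-refl , proj₁ (entails m sat) , []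

  Covers-[] : ∀ {A} → Covers [] A → ∀ β → IsModel β → ¬ (β isBetterThan A)
  Covers-[] covers β model better with covers β model better
  ... | _ , () , _

  IsModel⇒TModel-CDI : ∀ {s β} → IsModel β → ⟦ s ⟧s β → TModel T β (CDI T inst s)
  IsModel⇒TModel-CDI (consistent , entails) (satC , satD) =
    consistent , λ m sat → satC , satD , proj₂ (entails m sat)

  TModel-CDI⇒IsModel : ∀ {P s α} → Refines P → s ∈P P → TModel T α (CDI T inst s) → IsModel α
  TModel-CDI⇒IsModel {s = s} {α} refines s∈P (consistent , entails) =
    consistent , λ m sat → let satC , satD , satI = entails m sat in
                           refines s s∈P α (satC , satD) , satI

  module _ {P s P₀ P'} (Q : List (Subproblem T)) (split : Split T P s P₀) (P'≋ : P' ≋ₚ Q ++ P₀) where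

    Refines-replace : Refines P → (∀ t → t ∈P Q → ∀ α → ⟦ t ⟧s α → ⟦ s ⟧s α) → Refines P'
    Refines-replace refines Q⇒s t t∈P' α sat with ++⁻ Q (proj₁ (P'≋ t) t∈P')
    ... | inj₁ t∈Q  = refines s (Split-∈ split) α (Q⇒s t t∈Q α sat)
    ... | inj₂ t∈P₀ = refines t (Split-⊆ split t∈P₀) α sat

    Covers-replace : ∀ {A A'} → Covers P A →
      (∀ β → β isBetterThan A' → β isBetterThan A) →
      (∀ β → IsModel β → β isBetterThan A' → ⟦ s ⟧s β → ∃ λ t → t ∈P Q × ⟦ t ⟧s β) →
      Covers P' A'
    Covers-replace covers better⇒ s⇒Q β model better
      with covers β model (better⇒ β better)
    ... | t , t∈P , sat with Split-∈⁻ split t∈P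
    ... | inj₂ t∈P₀ = t , proj₂ (P'≋ t) (++⁺ʳ Q t∈P₀) , sat
    ... | inj₁ t≈s with s⇒Q β model better (⟦⟧s-resp-≈ t≈s sat)
    ...   | u , u∈Q , satu = u , proj₂ (P'≋ u) (++⁺ˡ u∈Q) , satu

  Invariant-replace : ∀ {P s P₀ P' A} Q → Split T P s P₀ → P' ≋ₚ Q ++ P₀ →
    (∀ β → IsModel β → ⟦ s ⟧s β → ∃ λ t → t ∈P Q × ⟦ t ⟧s β) →
    (∀ t → t ∈P Q → ∀ α → ⟦ t ⟧s α → ⟦ s ⟧s α) →
    Invariant (P , A) → Invariant (P' , A)
  Invariant-replace Q split P'≋ s⇒Q Q⇒s (best , refines , covers) =
    best , Refines-replace Q split P'≋ refines Q⇒s ,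
    Covers-replace Q split P'≋ covers (λ _ → id) (λ β model _ → s⇒Q β model)

  Invariant-rewrite : ∀ {P s P₀ P' A} t → Split T P s P₀ → P' ≋ₚ t ∷ P₀ →
    (∀ β → IsModel β → ⟦ s ⟧s β → ⟦ t ⟧s β) → (∀ α → ⟦ t ⟧s α → ⟦ s ⟧s α) →
    Invariant (P , A) → Invariant (P' , A)
  Invariant-rewrite t split P'≋ s⇒t t⇒s =
    Invariant-replace (t ∷ []) split P'≋
      (λ β model sat → t , here ≈-refl , s⇒t β model sat)
      (λ { u (here u≈t) α sat → t⇒s α (⟦⟧s-resp-≈ u≈t sat) })

  Invariant-discard : ∀ {P s P₀ P' A} → Split T P s P₀ → P' ≋ₚ P₀ →
    (∀ β → IsModel β → β isBetterThan A → ¬ ⟦ s ⟧s β) →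
    Invariant (P , A) → Invariant (P' , A)
  Invariant-discard split P'≋ noBetter (best , refines , covers) =
    best , Refines-replace [] split P'≋ refines (λ _ ()) ,
    Covers-replace [] split P'≋ covers (λ _ → id)
      (λ β model better sat → ⊥-elim (noBetter β model better sat))

  Invariant-retire : ∀ {P s P₀ P' A} A' → Split T P s P₀ → P' ≋ₚ P₀ →
    TModel T A' (CDI T inst s) → A' isBetterThan A →
    (∀ β → TModel T β (CDI T inst s) → obj T inst A' ≤ obj T inst β) →
    Invariant (P , A) → Invariant (P' , asg A')
  Invariant-retire A' split P'≋ modelA' A'<A optimal (_ , refines , covers) =
    best , Refines-replace [] split P'≋ refines (λ _ ()) ,
    Covers-replace [] split P'≋ covers (λ β β<A' → <∞-trans β<A' A'<A)
      (λ { β model (fin<fin β<A') sat →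
             ⊥-elim (ℤ.≤⇒≯ (optimal β (IsModel⇒TModel-CDI model sat)) β<A') })
    where
    best : BestIsModel (asg A')
    best α (inj₁ refl) = TModel-CDI⇒IsModel refines (Split-∈ split) modelA'
    best α (inj₂ ())

  Invariant-unbounded : ∀ {P s P₀ A} A' → Split T P s P₀ →
    TModel T A' (CDI T inst s) → Invariant (P , A) → Invariant ([] , unb A')
  Invariant-unbounded A' split modelA' (_ , refines , _) = best , (λ _ ()) , (λ _ _ ())
    where
    best : BestIsModel (unb A')
    best α (inj₁ ())
    best α (inj₂ refl) = TModel-CDI⇒IsModel refines (Split-∈ split) modelA'

  branch-cover : ∀ {D β} Cs → ⟦ D ⟧f β → Any (λ Ci → ⟦ Ci ⟧f β) Cs →
    ∃ λ t → t ∈P map (λ Ci → ⟨ Ci , D ⟩) Cs × ⟦ t ⟧s β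
  branch-cover Cs satD satCs = satisfied-∈P (map⁺ (Any.map (_, satD) satCs))

  branch-refine : ∀ {D α t} Cs → t ∈P map (λ Ci → ⟨ Ci , D ⟩) Cs → ⟦ t ⟧s α →
    Any (λ Ci → ⟦ Ci ⟧f α) Cs × ⟦ D ⟧f α
  branch-refine Cs t∈ sat =
    let satCs = map⁻ (∈P-satisfied t∈ sat) in
    Any.map proj₁ satCs , proj₂ (proj₂ (Any.satisfied satCs))

  module _ (lb : Subproblem T → ℤ∞) (validLB : ValidLB T inst lb) where

    Step-preserves-Invariant : ∀ {S S'} → Step T inst lb S S' → Invariant S → Invariant S'
    Step-preserves-Invariant (branch C D Cs split _ C⇔Cs _ P'≋) =
      Invariant-replace (map (λ Ci → ⟨ Ci , D ⟩) Cs) split P'≋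
        (λ β _ (satC , satD) → branch-cover Cs satD (proj₁ (C⇔Cs β satD) satC))
        (λ t t∈ α sat → let satCs , satD = branch-refine Cs t∈ sat in
                        proj₂ (C⇔Cs α satD) satCs , satD)
    Step-preserves-Invariant (learn C D c split _ CD⇒c P'≋) =
      Invariant-rewrite _ split P'≋
        (λ β _ (satC , satD) → CD⇒c β satC satD ∷ satC , satD)
        (λ α (satcC , satD) → All.tail satcC , satD)
    Step-preserves-Invariant (forget C D c split _ CD⇒c P'≋) =
      Invariant-rewrite _ split P'≋
        (λ β _ (satcC , satD) → All.tail satcC , satD)
        (λ α (satC , satD) → CD⇒c α satC satD ∷ satC , satD)
    Step-preserves-Invariant (propagate C D d split _ _ CD⇒d P'≋) =
      Invariant-rewrite _ split P'≋
        (λ β _ (satC , satD) → satC , CD⇒d β satC satD ∷ satD)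
        (λ α (satC , satdD) → satC , All.tail satdD)
    Step-preserves-Invariant (drop s split infeasible P'≋) =
      Invariant-discard split P'≋ (λ β _ _ → infeasible β)
    Step-preserves-Invariant (prune s split _ A≤lb P'≋) =
      Invariant-discard split P'≋
        (λ β _ better (satC , satD) → validLB s β satC satD (<∞-≤∞-trans better A≤lb))
    Step-preserves-Invariant (retire s A' split modelA' A'<A optimal P'≋) =
      Invariant-retire A' split P'≋ modelA' A'<A optimal
    Step-preserves-Invariant (unbounded s A' split modelA' _ _) =
      Invariant-unbounded A' split modelA'
    Step-preserves-Invariant (t-learn C D c split _ (F , CD⇒F , FI⇒c) P'≋) =
      Invariant-rewrite _ split P'≋
        (λ { β ((m , sat) , entails) (satC , satD) →
               FI⇒c β m sat (CD⇒F β satC satD) (proj₂ (entails m sat)) ∷ satC , satD })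
        (λ α (satcC , satD) → All.tail satcC , satD)

    Star-preserves-Invariant : ∀ {S S'} → Star (Step T inst lb) S S' → Invariant S → Invariant S'
    Star-preserves-Invariant =
      fold (λ S S' → Invariant S → Invariant S')
           (λ step rest → rest ∘ Step-preserves-Invariant step) id

theorem2 : {V : Set} (T : Theory V) (inst : Instance T)
    (lb : Subproblem T → ℤ∞) → ValidLB T inst lb →
    (A : Best T) → Star (Step T inst lb) (initial T inst) ([] , A) →
    (α : V → ℤ) → (A ≡ asg α ⊎ A ≡ unb α) →
    TModel T α (CI T inst)
      × (∀ (β : V → ℤ) → ¬ (TModel T β (CI T inst) × (fin (obj T inst β) <∞ objB T inst A)))
theorem2 T inst lb validLB A run α A≡α =
  best α A≡α , λ β (model , better) → Covers-[] covers β model better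
  where
  open Soundness T inst
  final : Invariant ([] , A)
  final = Star-preserves-Invariant lb validLB run Invariant-initial
  best : BestIsModel A
  best = proj₁ final
  covers : Covers [] A
  covers = proj₂ (proj₂ final)
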